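{- Let $\Sigma$ be an ordered alphabet, $n\ge1$, $w\in\Sigma^n$, and $\mathcal{L}(w)=\{\lambda\in\mathcal{L}^{(n)}:\lambda^{n/|\lambda|}\le w\}$. Then the concatenation, in lexicographic order, of the words $\lambda\in\mathcal{L}(w)$ is a prefix of $\mathrm{dB}_n$, and its length $\sum_{\lambda\in\mathcal{L}(w)}|\lambda|$ equals $|\mathcal{C}(w)|$.
   Context: A Lyndon word is a primitive word strictly smaller lexicographically than all its nontrivial cyclic rotations. $\mathcal{L}^{(n)}$ is the set of Lyndon words over $\Sigma$ whose length divides $n$. $\mathrm{dB}_n$ is the concatenation, in lexicographic order, of all words in $\mathcal{L}^{(n)}$ (the lexicographically minimal de Bruijn sequence of rank $n$). $\langle x\rangle$ is the lexicographically minimal cyclic rotation of $x$, and $\mathcal{C}(w)=\{x\in\Sigma^{n}:\langle x\rangle\le w\}$. -}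

module Defs where

open import Data.Nat using (ℕ; zero; suc; _/_)
open import Data.Nat.Divisibility using (_∣_)
open import Data.Nat.Divisibility using (_∣?_)
open import Data.Fin using (Fin; toℕ)
import Data.Fin.Properties as FinP
open import Data.List using (List; []; _∷_; _++_; length; map; concatMap; concat;
  replicate; take; drop; filter; foldr; upTo; sum)
open import Data.List.Relation.Binary.Lex.Strict as LexS using (Lex-<; Lex-≤)
open import Data.List.Relation.Binary.Pointwise using (Pointwise)
import Data.List.Sort
open import Data.Fin.Properties using (all?)
open import Data.Product using (_×_)
open import Relation.Binary.PropositionalEquality using (_≡_; _≢_)
open import Relation.Nullary using (Dec; yes; no; ¬_)
open import Relation.Nullary.Decidable using (_×-dec_; ¬?; _→-dec_)
open import Data.Fin using (zero; suc)

module _ (k : ℕ) where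

  Word : Set
  Word = List (Fin k)

  -- Strict and non-strict lexicographic order on words
  -- (a proper prefix is smaller).
  _<ₗ_ : Word → Word → Set
  _<ₗ_ = Lex-< _≡_ Data.Fin._<_

  _≤ₗ_ : Word → Word → Set
  _≤ₗ_ = Lex-≤ _≡_ Data.Fin._<_

  _<ₗ?_ : (x y : Word) → Dec (x <ₗ y)
  _<ₗ?_ = LexS.<-decidable FinP._≟_ FinP._<?_

  _≤ₗ?_ : (x y : Word) → Dec (x ≤ₗ y)
  _≤ₗ?_ = LexS.≤-decidable FinP._≟_ FinP._<?_

  open Data.List.Sort (LexS.≤-decTotalOrder (FinP.<-strictTotalOrder k))
    using (sort) public

  rot : ℕ → Word → Word
  rot i x = drop i x ++ take i x

  -- Lyndon word: nonempty, and strictly smaller than every nontrivial rotation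
  -- (this forces primitivity).
  Lyndon : Word → Set
  Lyndon x = (length x ≢ 0) × ((i : Fin (length x)) → toℕ i ≢ 0 → x <ₗ rot (toℕ i) x)

  lyndon? : (x : Word) → Dec (Lyndon x)
  lyndon? x = ¬? (length x Data.Nat.≟ 0)
    ×-dec all? (λ i → (¬? (toℕ i Data.Nat.≟ 0)) →-dec (x <ₗ? rot (toℕ i) x))
    where import Data.Nat

  allWords : ℕ → List Word
  allWords zero = [] ∷ []
  allWords (suc m) = concatMap (λ a → map (a ∷_) (allWords m)) (Data.List.allFin k)

  -- L^(n): Lyndon words whose length divides n, enumerated (for n ≥ 1
  -- every such length d satisfies 1 ≤ d ≤ n).
  LyndonDiv : ℕ → List Word
  LyndonDiv n = filter lyndon? (filter (λ x → length x ∣? n) (concatMap allWords (upTo (suc n))))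

  dB : ℕ → Word
  dB n = concat (sort (LyndonDiv n))

  -- integer division with the (irrelevant) convention m div 0 = 0
  _div_ : ℕ → ℕ → ℕ
  m div zero = 0
  m div suc d = m / suc d

  _^ʷ_ : Word → ℕ → Word
  x ^ʷ m = concat (replicate m x)

  Lw : ℕ → Word → List Word
  Lw n w = filter (λ l → (l ^ʷ (n div length l)) ≤ₗ? w) (LyndonDiv n)

  minₗ : Word → Word → Word
  minₗ x y with x ≤ₗ? y
  ... | yes _ = x
  ... | no  _ = y

  minRot : Word → Word
  minRot x = foldr (λ i r → minₗ (rot i x) r) x (upTo (length x))

  C : ℕ → Word → List Word
  C n w = filter (λ x → minRot x ≤ₗ? w) (allWords n)

module Submission where

-- A necklace (a word ≼ all of its conjugates) is a power of a unique
-- Lyndon word, and every power of a Lyndon word is a necklace. Hence Σ^n is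
-- the disjoint union, over l ∈ L^(n), of the conjugacy classes of the
-- necklaces l^(n/|l|); the class of l consists of |l| distinct rotations, all
-- with minimal rotation l^(n/|l|). So C(w) is the union of the classes of the
-- l with l^(n/|l|) ≼ w, that is l ∈ L(w), which gives the length statement.
-- For the prefix statement, l ↦ l^(n/|l|) is monotone on L^(n), so L(w) is
-- an initial segment of the sorted list L^(n) whose concatenation is dB_n.

open import Defs
open import Data.Nat using (ℕ; zero; suc; _+_; _*_; _∸_; _≤_; _<_; _≥_; z≤n; s≤s)
import Data.Nat as ℕ
import Data.Nat.Properties as ℕₚ
open import Data.Nat.Divisibility using (_∣_; _∣?_; ∣⇒≤; divides)
open import Data.Nat.DivMod using (m*n/n≡m)
open import Data.Nat.ListAction using (sum)
open import Data.Fin using (Fin; toℕ; fromℕ<)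
import Data.Fin.Properties as Finₚ
open import Data.List
  using (List; []; _∷_; _++_; length; map; concatMap; concat; take; drop; filter; foldr; upTo; applyUpTo; allFin)
open import Data.List.Properties
  using (∷-injectiveˡ; ∷-injectiveʳ; ++-assoc; ++-identityʳ; take++drop≡id; length-++; length-take; length-drop;
         length-++-≤ˡ; drop-drop; concat-++; filter-++; filter-all; filter-none; length-applyUpTo)
open import Data.List.Relation.Binary.Lex.Core using (base; halt; this; next)
import Data.List.Relation.Binary.Lex.Strict as Lex
import Data.List.Relation.Binary.Pointwise as Pointwise
open import Data.List.Relation.Binary.Prefix.Heterogeneous using (Prefix; fromView) renaming (_++_ to _++ᵛ_)
open import Data.List.Relation.Unary.All as All using (All; []; _∷_)
open import Data.List.Relation.Unary.AllPairs using (AllPairs; []; _∷_)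
open import Data.List.Relation.Unary.Any using (here; there)
open import Data.List.Relation.Unary.Unique.Propositional using (Unique)
import Data.List.Relation.Unary.Unique.Propositional.Properties as Unique
import Data.List.Relation.Unary.Sorted.TotalOrder.Properties as Sorted
open import Data.List.Membership.Propositional using (_∈_; find; lose)
open import Data.List.Membership.Propositional.Properties
  using (∈-upTo⁺; ∈-applyUpTo⁺; ∈-applyUpTo⁻; ∈-concatMap⁺; ∈-concatMap⁻; ∈-map⁺; ∈-map⁻; ∈-filter⁺; ∈-filter⁻;
         ∈-allFin)
open import Data.List.Membership.Propositional.Properties.WithK using (unique∧set⇒bag)
open import Data.List.Relation.Binary.BagAndSetEquality using (∼bag⇒↭)
import Data.List.Relation.Binary.Permutation.Propositional as Perm
open import Data.List.Relation.Binary.Permutation.Propositional.Properties using (↭-length; filter-↭; ∈-resp-↭)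
import Data.List.Relation.Binary.Permutation.Homogeneous as PermHomo
import Data.List.Sort
open import Data.Product using (∃; _×_; _,_; proj₁; proj₂)
open import Data.Nat.Induction using () renaming (<-wellFounded to ℕ-wf)
open import Induction.WellFounded using (Acc; acc)
open import Data.Sum using (_⊎_; inj₁; inj₂)
open import Data.Empty using (⊥; ⊥-elim)
open import Function.Base using (_∘_)
open import Function.Bundles using (mk⇔)
open import Relation.Binary using (DecTotalOrder; TotalOrder; tri<; tri≈; tri>)
open import Relation.Binary.PropositionalEquality
open import Relation.Nullary using (¬_; Dec; yes; no)
open import Relation.Nullary.Decidable using (¬?; _→-dec_)
open import Relation.Unary using (Decidable)


unique-same-members-length : ∀ {A : Set} {xs ys : List A} → Unique xs → Unique ys →
  (∀ {z} → z ∈ xs → z ∈ ys) → (∀ {z} → z ∈ ys → z ∈ xs) → length xs ≡ length ys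
unique-same-members-length xs! ys! to from =
  ↭-length (∼bag⇒↭ (unique∧set⇒bag xs! ys! (mk⇔ to from)))

concatMap-unique : ∀ {I B : Set} (f : I → List B) (is : List I) → Unique is →
  (∀ {i} → i ∈ is → Unique (f i)) →
  (∀ {i j z} → i ∈ is → j ∈ is → i ≢ j → z ∈ f i → z ∈ f j → ⊥) → Unique (concatMap f is)
concatMap-unique f [] _ _ _ = []
concatMap-unique f (i ∷ is) (i∉is ∷ is!) f! disjoint =
  Unique.++⁺ (f! (here refl)) (concatMap-unique f is is! (f! ∘ there) (λ p q → disjoint (there p) (there q)))
    (λ (z∈fi , z∈rest) → let j , j∈is , z∈fj = find (∈-concatMap⁻ f {is} z∈rest)
                         in disjoint (here refl) (there j∈is) (All.lookup i∉is j∈is) z∈fi z∈fj)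

filter-down-closed-prefix : ∀ {A : Set} {R : A → A → Set} {Q : A → Set} (Q? : Decidable Q) (xs : List A) →
  AllPairs R xs → (∀ {a b} → a ∈ xs → b ∈ xs → R a b → Q b → Q a) →
  ∃ λ zs → xs ≡ filter Q? xs ++ zs
filter-down-closed-prefix Q? [] _ _ = [] , refl
filter-down-closed-prefix Q? (x ∷ xs) (x≤xs ∷ xs↗) down with Q? x
... | yes _ = let zs , xs≡ = filter-down-closed-prefix Q? xs xs↗ (λ a b → down (there a) (there b))
              in zs , cong (x ∷_) xs≡
... | no ¬Qx = x ∷ xs , sym (cong (_++ x ∷ xs) (filter-none Q? (All.tabulate ¬Q)))
  where
    ¬Q : ∀ {y} → y ∈ xs → ¬ _
    ¬Q y∈ Qy = ¬Qx (down (here refl) (there y∈) (All.lookup x≤xs y∈) Qy)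

-- Combinatorics on words over the ordered alphabet Σ = Fin k.
module Combinatorics (k : ℕ) where

  W : Set
  W = Word k

  infix 4 _≼_ _≺_
  _≼_ _≺_ : W → W → Set
  _≼_ = _≤ₗ_ k
  _≺_ = _<ₗ_ k

  lexOrder : DecTotalOrder _ _ _
  lexOrder = Lex.≤-decTotalOrder (Finₚ.<-strictTotalOrder k)

  lexTotalOrder : TotalOrder _ _ _
  lexTotalOrder = DecTotalOrder.totalOrder lexOrder

  open Data.List.Sort lexOrder using (sort-↭; sort-↗)

  ≼-refl : ∀ {x} → x ≼ x
  ≼-refl = DecTotalOrder.refl lexOrder

  ≼-trans : ∀ {x y z} → x ≼ y → y ≼ z → x ≼ z
  ≼-trans = DecTotalOrder.trans lexOrder

  ≼-antisym : ∀ {x y} → x ≼ y → y ≼ x → x ≡ y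
  ≼-antisym p q = Pointwise.Pointwise-≡⇒≡ (DecTotalOrder.antisym lexOrder p q)

  ≼-reflexive : ∀ {x y} → x ≡ y → x ≼ y
  ≼-reflexive refl = ≼-refl

  ≺-irrefl : ∀ {x} → ¬ (x ≺ x)
  ≺-irrefl = Lex.<-irreflexive Finₚ.<-irrefl (Pointwise.≡⇒Pointwise-≡ refl)

  ≺⇒≼ : ∀ {x y} → x ≺ y → x ≼ y
  ≺⇒≼ halt = halt
  ≺⇒≼ (this a<b) = this a<b
  ≺⇒≼ (next refl p) = next refl (≺⇒≼ p)

  ≼⇒≺⊎≡ : ∀ {x y} → x ≼ y → x ≺ y ⊎ x ≡ y
  ≼⇒≺⊎≡ (base _) = inj₂ refl
  ≼⇒≺⊎≡ halt = inj₁ halt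
  ≼⇒≺⊎≡ (this a<b) = inj₁ (this a<b)
  ≼⇒≺⊎≡ (next refl p) with ≼⇒≺⊎≡ p
  ... | inj₁ q = inj₁ (next refl q)
  ... | inj₂ refl = inj₂ refl

  ≺-extend : ∀ {x y} x' y' → x ≺ y → length x ≡ length y → (x ++ x') ≺ (y ++ y')
  ≺-extend x' y' halt ()
  ≺-extend x' y' (this a<b) _ = this a<b
  ≺-extend x' y' (next refl p) e = next refl (≺-extend x' y' p (ℕₚ.suc-injective e))

  ≼-prefix : ∀ x y {x' y'} → (x ++ x') ≼ (y ++ y') → length x ≡ length y → x ≼ y
  ≼-prefix [] [] _ _ = base _
  ≼-prefix (a ∷ x) (b ∷ y) (this a<b) _ = this a<b
  ≼-prefix (a ∷ x) (b ∷ y) (next refl p) e = next refl (≼-prefix x y p (ℕₚ.suc-injective e))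

  ≼-prepend : ∀ c {x y} → x ≼ y → (c ++ x) ≼ (c ++ y)
  ≼-prepend [] p = p
  ≼-prepend (a ∷ c) p = next refl (≼-prepend c p)

  ≺-cases : ∀ {x y} → x ≺ y →
            (∃ λ v → y ≡ x ++ v × v ≢ []) ⊎ (∀ x' y' → (x ++ x') ≺ (y ++ y'))
  ≺-cases (halt {y} {ys}) = inj₁ (y ∷ ys , refl , λ ())
  ≺-cases (this a<b) = inj₂ (λ _ _ → this a<b)
  ≺-cases (next refl p) with ≺-cases p
  ... | inj₁ (v , refl , v≢[]) = inj₁ (v , refl , v≢[])
  ... | inj₂ f = inj₂ (λ x' y' → next refl (f x' y'))

  levi : ∀ (u v p q : W) → u ++ v ≡ p ++ q →
         (∃ λ w → u ≡ p ++ w × q ≡ w ++ v) ⊎ (∃ λ w → p ≡ u ++ w × v ≡ w ++ q)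
  levi [] v p q e = inj₂ (p , refl , e)
  levi (a ∷ u) v [] q e = inj₁ (a ∷ u , refl , sym e)
  levi (a ∷ u) v (b ∷ p) q e with refl ← ∷-injectiveˡ e with levi u v p q (∷-injectiveʳ e)
  ... | inj₁ (w , refl , e') = inj₁ (w , refl , e')
  ... | inj₂ (w , refl , e') = inj₂ (w , refl , e')

  ++-prefix-unique : ∀ (x y : W) {x' y'} → x ++ x' ≡ y ++ y' → length x ≡ length y → x ≡ y
  ++-prefix-unique [] [] _ _ = refl
  ++-prefix-unique (a ∷ x) (b ∷ y) e l with refl ← ∷-injectiveˡ e =
    cong (a ∷_) (++-prefix-unique x y (∷-injectiveʳ e) (ℕₚ.suc-injective l))

  length-take-≤ : ∀ i (x : W) → i ≤ length x → length (take i x) ≡ i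
  length-take-≤ i x i≤ = trans (length-take i x) (ℕₚ.m≤n⇒m⊓n≡m i≤)

  nonempty⇒length≢0 : ∀ {u : W} → u ≢ [] → length u ≢ 0
  nonempty⇒length≢0 {[]} u≢[] _ = u≢[] refl
  nonempty⇒length≢0 {_ ∷ _} _ ()

  ++-nonempty : ∀ (u : W) {q} → u ≢ [] → u ++ q ≢ []
  ++-nonempty [] u≢[] _ = u≢[] refl
  ++-nonempty (_ ∷ _) _ ()

  proper-prefix-shorter : ∀ (u v : W) → v ≢ [] → length u < length (u ++ v)
  proper-prefix-shorter u v v≢[] =
    subst (length u <_) (sym (length-++ u)) (ℕₚ.m<m+n _ (ℕₚ.n≢0⇒n>0 (nonempty⇒length≢0 v≢[])))

  infixr 8 _^_
  _^_ : W → ℕ → W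
  x ^ m = _^ʷ_ k x m

  ^-+ : ∀ x a b → x ^ a ++ x ^ b ≡ x ^ (a + b)
  ^-+ x zero b = refl
  ^-+ x (suc a) b = trans (++-assoc x (x ^ a) (x ^ b)) (cong (x ++_) (^-+ x a b))

  ^-comm : ∀ x a → x ++ x ^ a ≡ x ^ a ++ x
  ^-comm x zero = ++-identityʳ x
  ^-comm x (suc a) = trans (cong (x ++_) (^-comm x a)) (sym (++-assoc x (x ^ a) x))

  length-^ : ∀ x a → length (x ^ a) ≡ a * length x
  length-^ x zero = refl
  length-^ x (suc a) = trans (length-++ x) (cong (length x +_) (length-^ x a))

  ^-* : ∀ y e c → (y ^ e) ^ c ≡ y ^ (c * e)
  ^-* y e zero = refl
  ^-* y e (suc c) = trans (cong (y ^ e ++_) (^-* y e c)) (^-+ y e (c * e))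

  rotate : ℕ → W → W
  rotate = rot k

  rotate-++ : ∀ (u v : W) → rotate (length u) (u ++ v) ≡ v ++ u
  rotate-++ u v = cong₂ _++_ (drop-length u) (take-length u)
    where
      drop-length : ∀ (u : W) → drop (length u) (u ++ v) ≡ v
      drop-length [] = refl
      drop-length (_ ∷ u) = drop-length u
      take-length : ∀ (u : W) → take (length u) (u ++ v) ≡ u
      take-length [] = refl
      take-length (a ∷ u) = cong (a ∷_) (take-length u)

  rotated-power : ∀ u₁ u₂ c → u₂ ++ (u₁ ++ u₂) ^ c ++ u₁ ≡ (u₂ ++ u₁) ^ suc c
  rotated-power u₁ u₂ zero = sym (++-identityʳ (u₂ ++ u₁))
  rotated-power u₁ u₂ (suc c) = begin
      u₂ ++ ((u₁ ++ u₂) ++ P) ++ u₁ ≡⟨ cong (u₂ ++_) (++-assoc (u₁ ++ u₂) P u₁) ⟩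
      u₂ ++ (u₁ ++ u₂) ++ P ++ u₁   ≡⟨ cong (u₂ ++_) (++-assoc u₁ u₂ (P ++ u₁)) ⟩
      u₂ ++ u₁ ++ u₂ ++ P ++ u₁     ≡⟨ sym (++-assoc u₂ u₁ _) ⟩
      (u₂ ++ u₁) ++ u₂ ++ P ++ u₁   ≡⟨ cong ((u₂ ++ u₁) ++_) (rotated-power u₁ u₂ c) ⟩
      (u₂ ++ u₁) ^ suc (suc c)      ∎
    where
      open ≡-Reasoning
      P : W
      P = (u₁ ++ u₂) ^ c

  rotate-^-++ : ∀ u v a → rotate (length u) ((u ++ v) ^ suc a) ≡ (v ++ u) ^ suc a
  rotate-^-++ u v a = begin
    rotate (length u) ((u ++ v) ++ (u ++ v) ^ a) ≡⟨ cong (rotate (length u)) (++-assoc u v _) ⟩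
    rotate (length u) (u ++ v ++ (u ++ v) ^ a)   ≡⟨ rotate-++ u _ ⟩
    (v ++ (u ++ v) ^ a) ++ u                     ≡⟨ ++-assoc v _ u ⟩
    v ++ (u ++ v) ^ a ++ u                       ≡⟨ rotated-power u v a ⟩
    (v ++ u) ^ suc a                             ∎
    where open ≡-Reasoning

  rotate-^ : ∀ i l a → i ≤ length l → rotate i (l ^ suc a) ≡ (rotate i l) ^ suc a
  rotate-^ i l a i≤ =
    subst₂ (λ t j → rotate j (t ^ suc a) ≡ (rotate i l) ^ suc a)
           (take++drop≡id i l) (length-take-≤ i l i≤) (rotate-^-++ (take i l) (drop i l) a)

  power-factorisation : ∀ l a u v → u ++ v ≡ l ^ suc a →
    ∃ λ u₁ → ∃ λ u₂ → ∃ λ s → ∃ λ t →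
      l ≡ u₁ ++ u₂ × u ≡ l ^ s ++ u₁ × v ≡ u₂ ++ l ^ t × s + t ≡ a
  power-factorisation l zero u v e =
    u , v , 0 , 0 , trans (sym (++-identityʳ l)) (sym e) , refl , sym (++-identityʳ v) , refl
  power-factorisation l (suc a) u v e with levi u v l (l ^ suc a) e
  ... | inj₂ (w , l≡uw , v≡w++) = u , w , 0 , suc a , l≡uw , refl , v≡w++ , refl
  ... | inj₁ (w , refl , e') with power-factorisation l a w v (sym e')
  ... | u₁ , u₂ , s , t , l≡ , refl , v≡ , s+t =
    u₁ , u₂ , suc s , t , l≡ , sym (++-assoc l (l ^ s) u₁) , v≡ , cong suc s+t

  conjugate-of-power : ∀ l a u v → u ++ v ≡ l ^ suc a →
    ∃ λ u₁ → ∃ λ u₂ → l ≡ u₁ ++ u₂ × v ++ u ≡ (u₂ ++ u₁) ^ suc a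
  conjugate-of-power l a u v e with power-factorisation l a u v e
  ... | u₁ , u₂ , s , t , refl , refl , refl , refl = u₁ , u₂ , refl , (begin
      (u₂ ++ L ^ t) ++ L ^ s ++ u₁  ≡⟨ ++-assoc u₂ (L ^ t) _ ⟩
      u₂ ++ L ^ t ++ L ^ s ++ u₁    ≡⟨ cong (u₂ ++_) (sym (++-assoc (L ^ t) (L ^ s) u₁)) ⟩
      u₂ ++ (L ^ t ++ L ^ s) ++ u₁  ≡⟨ cong (λ z → u₂ ++ z ++ u₁) (^-+ L t s) ⟩
      u₂ ++ L ^ (t + s) ++ u₁       ≡⟨ rotated-power u₁ u₂ (t + s) ⟩
      (u₂ ++ u₁) ^ suc (t + s)      ≡⟨ cong (λ z → (u₂ ++ u₁) ^ suc z) (ℕₚ.+-comm t s) ⟩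
      (u₂ ++ u₁) ^ suc (s + t)      ∎)
    where
      open ≡-Reasoning
      L : W
      L = u₁ ++ u₂

  Conj : W → W → Set
  Conj x y = ∃ λ u → ∃ λ v → x ≡ u ++ v × y ≡ v ++ u

  conj-sym : ∀ {x y} → Conj x y → Conj y x
  conj-sym (u , v , e₁ , e₂) = v , u , e₂ , e₁

  conj-trans : ∀ {x y z} → Conj x y → Conj y z → Conj x z
  conj-trans (u , v , refl , e) (s , t , e' , refl) with levi v u s t (trans (sym e) e')
  ... | inj₁ (w , refl , refl) = u ++ s , w , sym (++-assoc u s w) , ++-assoc w u s
  ... | inj₂ (w , refl , refl) = w , t ++ v , ++-assoc w t v , sym (++-assoc t v w)

  conj-rotate : ∀ i x → Conj x (rotate i x)
  conj-rotate i x = take i x , drop i x , sym (take++drop≡id i x) , refl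

  conj-length : ∀ {x y} → Conj x y → length y ≡ length x
  conj-length (u , v , refl , refl) = begin
    length (v ++ u)         ≡⟨ length-++ v ⟩
    length v + length u     ≡⟨ ℕₚ.+-comm (length v) (length u) ⟩
    length u + length v     ≡⟨ length-++ u ⟨
    length (u ++ v)         ∎
    where open ≡-Reasoning

  conjugate-of-power-is-rotation : ∀ {l z} a → l ≢ [] → Conj (l ^ suc a) z →
    ∃ λ i → i < length l × z ≡ rotate i (l ^ suc a)
  conjugate-of-power-is-rotation {l} a l≢[] (u , v , e , refl)
    with conjugate-of-power l a u v (sym e)
  ... | u₁ , [] , refl , z≡ = 0 , ℕₚ.n≢0⇒n>0 (nonempty⇒length≢0 l≢[]) , (begin
      v ++ u                      ≡⟨ z≡ ⟩
      u₁ ^ suc a                  ≡⟨ cong (_^ suc a) (++-identityʳ u₁) ⟨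
      (u₁ ++ []) ^ suc a          ≡⟨ ++-identityʳ _ ⟨
      rotate 0 ((u₁ ++ []) ^ suc a) ∎)
    where open ≡-Reasoning
  ... | u₁ , c ∷ u₂ , refl , z≡ =
    length u₁ , proper-prefix-shorter u₁ (c ∷ u₂) (λ ()) , trans z≡ (sym (rotate-^-++ u₁ (c ∷ u₂) a))

  Necklace : W → Set
  Necklace m = ∀ y → Conj m y → m ≼ y

  ⟨_⟩ : W → W
  ⟨ x ⟩ = minRot k x

  private
    minOver : W → List ℕ → W
    minOver x is = foldr (λ i r → minₗ k (rotate i x) r) x is

    min-≼ˡ : ∀ a b → minₗ k a b ≼ a
    min-≼ˡ a b with _≤ₗ?_ k a b
    ... | yes _ = ≼-refl
    ... | no a⋠b with DecTotalOrder.total lexOrder a b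
    ...   | inj₁ a≼b = ⊥-elim (a⋠b a≼b)
    ...   | inj₂ b≼a = b≼a

    min-≼ʳ : ∀ a b → minₗ k a b ≼ b
    min-≼ʳ a b with _≤ₗ?_ k a b
    ... | yes a≼b = a≼b
    ... | no _ = ≼-refl

    minOver-conj : ∀ x is → Conj x (minOver x is)
    minOver-conj x [] = [] , x , refl , sym (++-identityʳ x)
    minOver-conj x (i ∷ is) with _≤ₗ?_ k (rotate i x) (minOver x is)
    ... | yes _ = conj-rotate i x
    ... | no _ = minOver-conj x is

    minOver-≼-rotate : ∀ x is {i} → i ∈ is → minOver x is ≼ rotate i x
    minOver-≼-rotate x (j ∷ is) (here refl) = min-≼ˡ (rotate j x) (minOver x is)
    minOver-≼-rotate x (j ∷ is) (there i∈) =
      ≼-trans (min-≼ʳ (rotate j x) (minOver x is)) (minOver-≼-rotate x is i∈)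

    minOver-≼-self : ∀ x is → minOver x is ≼ x
    minOver-≼-self x [] = ≼-refl
    minOver-≼-self x (j ∷ is) = ≼-trans (min-≼ʳ (rotate j x) (minOver x is)) (minOver-≼-self x is)

  conj-⟨⟩ : ∀ x → Conj x ⟨ x ⟩
  conj-⟨⟩ x = minOver-conj x (upTo (length x))

  -- ⟨ x ⟩ lies below every conjugate of x: a conjugate v u of x = u v is
  -- either x itself (v empty) or its rotation by |u| < |x|.
  ⟨⟩-least : ∀ {x y} → Conj x y → ⟨ x ⟩ ≼ y
  ⟨⟩-least (u , [] , refl , refl) =
    subst (⟨ u ++ [] ⟩ ≼_) (++-identityʳ u) (minOver-≼-self (u ++ []) (upTo (length (u ++ []))))
  ⟨⟩-least (u , v@(_ ∷ _) , refl , refl) =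
    subst (⟨ u ++ v ⟩ ≼_) (rotate-++ u v)
      (minOver-≼-rotate (u ++ v) (upTo (length (u ++ v))) (∈-upTo⁺ (proper-prefix-shorter u v (λ ()))))

  ⟨⟩-necklace : ∀ x → Necklace ⟨ x ⟩
  ⟨⟩-necklace x y c = ⟨⟩-least (conj-trans (conj-⟨⟩ x) c)

  ⟨⟩-of-necklace : ∀ {m y} → Necklace m → Conj m y → ⟨ y ⟩ ≡ m
  ⟨⟩-of-necklace {m} {y} m-neck c =
    ≼-antisym (⟨⟩-least (conj-sym c)) (m-neck ⟨ y ⟩ (conj-trans c (conj-⟨⟩ y)))

  []-^ : ∀ m → [] ^ m ≡ []
  []-^ zero = refl
  []-^ (suc m) = []-^ m

  commuting-words : ∀ u v → u ++ v ≡ v ++ u →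
    ∃ λ y → ∃ λ p → ∃ λ q → u ≡ y ^ p × v ≡ y ^ q
  commuting-words u v = go u v (ℕ-wf (length u + length v))
    where
      shorter : ∀ (v w : W) → v ≢ [] → length v + length w < length (v ++ w) + length v
      shorter v w v≢[] = subst (_< length (v ++ w) + length v) (length-++ v)
        (ℕₚ.m<m+n (length (v ++ w)) (ℕₚ.n≢0⇒n>0 (nonempty⇒length≢0 v≢[])))

      go : ∀ u v → Acc _<_ (length u + length v) → u ++ v ≡ v ++ u →
           ∃ λ y → ∃ λ p → ∃ λ q → u ≡ y ^ p × v ≡ y ^ q
      go [] v _ _ = v , 0 , 1 , refl , sym (++-identityʳ v)
      go u@(_ ∷ _) [] _ _ = u , 1 , 0 , sym (++-identityʳ u) , refl
      go u@(_ ∷ _) v@(_ ∷ _) (acc rec) e with levi u v v u e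
      ... | inj₁ (w , refl , e') with go v w (rec (shorter v w (λ ()))) e'
      ...   | y , p , q , v≡ , w≡ = y , p + q , p , trans (cong₂ _++_ v≡ w≡) (^-+ y p q) , v≡
      go u@(_ ∷ _) v@(_ ∷ _) (acc rec) e | inj₂ (w , refl , e')
        with go u w (rec (subst (length u + length w <_) (ℕₚ.+-comm (length (u ++ w)) (length u))
                                (shorter u w (λ ())))) e'
      ...   | y , p , q , u≡ , w≡ = y , p , p + q , u≡ , trans (cong₂ _++_ u≡ w≡) (^-+ y p q)

  commuting⇒proper-power : ∀ u v → u ++ v ≡ v ++ u → u ≢ [] → v ≢ [] →
    ∃ λ y → ∃ λ e → y ≢ [] × length y ≤ length u × u ++ v ≡ y ^ suc (suc e)
  commuting⇒proper-power u v e u≢[] v≢[] with commuting-words u v e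
  ... | y , zero , q , refl , _ = ⊥-elim (u≢[] refl)
  ... | y , suc p , zero , _ , refl = ⊥-elim (v≢[] refl)
  ... | y , suc p , suc q , refl , refl =
    y , p + q , y≢[] , ℕₚ.≤-trans (ℕₚ.m≤m+n (length y) _) (ℕₚ.≤-reflexive (sym (length-++ y))) ,
    trans (^-+ y (suc p) (suc q)) (cong (λ r → y ^ suc r) (ℕₚ.+-suc p q))
    where
      y≢[] : y ≢ []
      y≢[] refl = u≢[] ([]-^ (suc p))

  lyndon-nonempty : ∀ {l} → Lyndon k l → l ≢ []
  lyndon-nonempty (l≢0 , _) refl = l≢0 refl

  lyndon-split : ∀ u v → Lyndon k (u ++ v) → u ≢ [] → v ≢ [] → (u ++ v) ≺ (v ++ u)
  lyndon-split u v (_ , smaller) u≢[] v≢[] =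
    subst ((u ++ v) ≺_) (rotate-++ u v)
      (subst (λ j → (u ++ v) ≺ rotate j (u ++ v)) (Finₚ.toℕ-fromℕ< |u|<)
        (smaller (fromℕ< |u|<) (λ e → nonempty⇒length≢0 u≢[] (trans (sym (Finₚ.toℕ-fromℕ< |u|<)) e))))
    where
      |u|< : length u < length (u ++ v)
      |u|< = proper-prefix-shorter u v v≢[]

  lyndon-uncommuting : ∀ u v → Lyndon k (u ++ v) → u ++ v ≡ v ++ u → u ≢ [] → v ≢ [] → ⊥
  lyndon-uncommuting u v L e u≢[] v≢[] = ≺-irrefl (subst ((u ++ v) ≺_) (sym e) (lyndon-split u v L u≢[] v≢[]))

  lyndon-primitive : ∀ r e → ¬ Lyndon k (r ^ suc (suc e))
  lyndon-primitive r e L = lyndon-uncommuting r (r ^ suc e) L (^-comm r (suc e)) r≢[] (++-nonempty r r≢[])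
    where
      r≢[] : r ≢ []
      r≢[] refl = lyndon-nonempty L ([]-^ (suc (suc e)))

  lyndon-conjugate-uncommuting : ∀ {l} s t → Lyndon k l → Conj l (s ++ t) → s ++ t ≡ t ++ s →
    s ≢ [] → t ≢ [] → ⊥
  lyndon-conjugate-uncommuting s t L c e s≢[] t≢[] with commuting⇒proper-power s t e s≢[] t≢[]
  ... | y , d , _ , _ , st≡ with conj-sym c
  ... | u , v , st≡uv , l≡ with conjugate-of-power y (suc d) u v (trans (sym st≡uv) st≡)
  ... | y₁ , y₂ , _ , l≡' = lyndon-primitive (y₂ ++ y₁) d (subst (Lyndon k) (trans l≡ l≡') L)

  lyndon-power-necklace : ∀ l a → Lyndon k l → Necklace (l ^ suc a)
  lyndon-power-necklace l a L y (u , v , e , refl) with conjugate-of-power l a u v (sym e)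
  ... | [] , u₂ , refl , y≡ = ≼-reflexive (trans (cong (_^ suc a) (sym (++-identityʳ u₂))) (sym y≡))
  ... | u₁@(_ ∷ _) , [] , refl , y≡ = ≼-reflexive (trans (cong (_^ suc a) (++-identityʳ u₁)) (sym y≡))
  ... | u₁@(_ ∷ _) , u₂@(_ ∷ _) , refl , y≡ =
    subst ((u₁ ++ u₂) ^ suc a ≼_) (sym y≡)
      (≺⇒≼ (≺-extend _ _ (lyndon-split u₁ u₂ L (λ ()) (λ ())) (sym (conj-length (u₁ , u₂ , refl , refl)))))

  -- The proper rotations of a Lyndon word are pairwise distinct: if
  -- rotate i l = rotate j l with i < j, the common value factors as w t = t w.
  lyndon-rotations-distinct : ∀ {l} i j → Lyndon k l → i < j → j < length l → rotate i l ≢ rotate j l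
  lyndon-rotations-distinct {l} i j L i<j j<l rot≡
    with levi (take i l) (drop i l) (take j l) (drop j l) (trans (take++drop≡id i l) (sym (take++drop≡id j l)))
  ... | inj₁ (w , ti≡ , _) =
    ℕₚ.<⇒≱ i<j (subst₂ _≤_ (length-take-≤ j l (ℕₚ.<⇒≤ j<l))
                           (trans (cong length (sym ti≡)) (length-take-≤ i l (ℕₚ.<⇒≤ (ℕₚ.<-trans i<j j<l))))
                           (length-++-≤ˡ (take j l)))
  ... | inj₂ (w , tj≡ , di≡) =
    lyndon-conjugate-uncommuting w (drop j l ++ take i l) L (subst (Conj l) rotᵢ (conj-rotate i l))
      (trans (sym rotᵢ) (trans rot≡ rotⱼ)) w≢[] (++-nonempty (drop j l) dj≢[])
    where
      rotᵢ : rotate i l ≡ w ++ drop j l ++ take i l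
      rotᵢ = trans (cong (_++ take i l) di≡) (++-assoc w (drop j l) (take i l))
      rotⱼ : rotate j l ≡ (drop j l ++ take i l) ++ w
      rotⱼ = trans (cong (drop j l ++_) tj≡) (sym (++-assoc (drop j l) (take i l) w))
      w≢[] : w ≢ []
      w≢[] refl = ℕₚ.<⇒≢ i<j (begin
        i                        ≡⟨ length-take-≤ i l (ℕₚ.<⇒≤ (ℕₚ.<-trans i<j j<l)) ⟨
        length (take i l)        ≡⟨ cong length (++-identityʳ (take i l)) ⟨
        length (take i l ++ [])  ≡⟨ cong length tj≡ ⟨
        length (take j l)        ≡⟨ length-take-≤ j l (ℕₚ.<⇒≤ j<l) ⟩
        j                        ∎)
        where open ≡-Reasoning
      dj≢[] : drop j l ≢ []
      dj≢[] e = ℕₚ.<⇒≱ j<l (ℕₚ.m∸n≡0⇒m≤n (trans (sym (length-drop j l)) (cong length e)))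

  lyndon-power-rotations-distinct : ∀ {l} a i j → Lyndon k l → i < j → j < length l →
    rotate i (l ^ suc a) ≢ rotate j (l ^ suc a)
  lyndon-power-rotations-distinct {l} a i j L i<j j<l e =
    lyndon-rotations-distinct i j L i<j j<l
      (++-prefix-unique (rotate i l) (rotate j l)
        (trans (sym (rotate-^ i l a (ℕₚ.<⇒≤ (ℕₚ.<-trans i<j j<l)))) (trans e (rotate-^ j l a (ℕₚ.<⇒≤ j<l))))
        (trans (conj-length (conj-rotate i l)) (sym (conj-length (conj-rotate j l)))))

  no-shorter-root : ∀ {l m} a b → Lyndon k m → l ≢ [] → length l < length m → l ^ suc a ≢ m ^ suc b
  no-shorter-root {l} {m} a b M l≢[] |l|<|m| E with levi l (l ^ a) m (m ^ b) E
  ... | inj₁ (w , l≡mw , _) = ℕₚ.<⇒≱ |l|<|m| (subst (length m ≤_) (cong length (sym l≡mw)) (length-++-≤ˡ m))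
  ... | inj₂ (u , refl , lᵃ≡) =
    lyndon-uncommuting l u M (++-prefix-unique (l ++ u) (u ++ l) powers≡ (sym (conj-length (l , u , refl , refl))))
      l≢[] u≢[]
    where
      open ≡-Reasoning
      powers≡ : (l ++ u) ^ suc b ≡ (u ++ l) ^ suc b
      powers≡ = begin
        (l ++ u) ^ suc b         ≡⟨ E ⟨
        l ++ l ^ a               ≡⟨ ^-comm l a ⟩
        l ^ a ++ l               ≡⟨ cong (_++ l) lᵃ≡ ⟩
        (u ++ (l ++ u) ^ b) ++ l ≡⟨ ++-assoc u _ l ⟩
        u ++ (l ++ u) ^ b ++ l   ≡⟨ rotated-power l u b ⟩
        (u ++ l) ^ suc b         ∎
      u≢[] : u ≢ []
      u≢[] refl = ℕₚ.<-irrefl (cong length (sym (++-identityʳ l))) |l|<|m|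

  lyndon-root-unique : ∀ {l m} a b → Lyndon k l → Lyndon k m → l ^ suc a ≡ m ^ suc b → l ≡ m
  lyndon-root-unique {l} {m} a b L M E with ℕₚ.<-cmp (length l) (length m)
  ... | tri< |l|<|m| _ _ = ⊥-elim (no-shorter-root a b M (lyndon-nonempty L) |l|<|m| E)
  ... | tri≈ _ |l|≡|m| _ = ++-prefix-unique l m E |l|≡|m|
  ... | tri> _ _ |m|<|l| = ⊥-elim (no-shorter-root b a L (lyndon-nonempty M) |m|<|l| (sym E))

  necklace-power-≼-rotation : ∀ z c i → i ≤ length z → Necklace (z ^ suc c) → z ≼ rotate i z
  necklace-power-≼-rotation z c i i≤ neck =
    ≼-prefix z (rotate i z) (subst (z ^ suc c ≼_) (rotate-^ i z c i≤) (neck _ (conj-rotate i (z ^ suc c))))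
             (sym (conj-length (conj-rotate i z)))

  non-lyndon-witness : ∀ z → z ≢ [] → ¬ Lyndon k z →
    ∃ λ i → 0 < i × i < length z × ¬ (z ≺ rotate i z)
  non-lyndon-witness z z≢[] ¬L
    with Finₚ.¬∀⟶∃¬ (length z) _ (λ i → ¬? (toℕ i ℕ.≟ 0) →-dec _<ₗ?_ k z (rotate (toℕ i) z))
                    (λ all-smaller → ¬L (nonempty⇒length≢0 z≢[] , all-smaller))
  ... | i , ¬smaller =
    toℕ i , ℕₚ.n≢0⇒n>0 (λ i≡0 → ¬smaller (λ i≢0 → ⊥-elim (i≢0 i≡0))) , Finₚ.toℕ<n i ,
    λ z≺ → ¬smaller (λ _ → z≺)

  -- If z is not Lyndon but z^(c+1) is a necklace, then z^(c+1) is a power of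
  -- a strictly shorter word: the witness rotation equals z, so z = u v = v u.
  non-lyndon-shorter-root : ∀ z c → z ≢ [] → ¬ Lyndon k z → Necklace (z ^ suc c) →
    ∃ λ y → ∃ λ e → y ≢ [] × length y < length z × z ^ suc c ≡ y ^ suc e
  non-lyndon-shorter-root z c z≢[] ¬L neck with non-lyndon-witness z z≢[] ¬L
  ... | i , 0<i , i<|z| , z⊀ with ≼⇒≺⊎≡ (necklace-power-≼-rotation z c i (ℕₚ.<⇒≤ i<|z|) neck)
  ...   | inj₁ z≺ = ⊥-elim (z⊀ z≺)
  ...   | inj₂ z≡rot with commuting⇒proper-power u v (trans uv≡z z≡rot) u≢[] v≢[]
    where
      u v : W
      u = take i z
      v = drop i z
      uv≡z : u ++ v ≡ z
      uv≡z = take++drop≡id i z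
      |u| : length u ≡ i
      |u| = length-take-≤ i z (ℕₚ.<⇒≤ i<|z|)
      u≢[] : u ≢ []
      u≢[] e = ℕₚ.<⇒≢ 0<i (trans (cong length (sym e)) |u|)
      v≢[] : v ≢ []
      v≢[] e = ℕₚ.<⇒≱ i<|z| (ℕₚ.m∸n≡0⇒m≤n (trans (sym (length-drop i z)) (cong length e)))
  ... | y , e , y≢[] , |y|≤ , uv≡yᵉ =
    y , suc e + c * suc (suc e) , y≢[] ,
    ℕₚ.≤-<-trans |y|≤ (subst (_< length z) (sym (length-take-≤ i z (ℕₚ.<⇒≤ i<|z|))) i<|z|) ,
    trans (cong (_^ suc c) (trans (sym (take++drop≡id i z)) uv≡yᵉ)) (^-* y (suc (suc e)) (suc c))

  -- Every nonempty necklace is a power of a Lyndon word (induction on the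
  -- length of a root z of the necklace z^(c+1)).
  necklace-lyndon-root : ∀ m → m ≢ [] → Necklace m → ∃ λ l → ∃ λ e → Lyndon k l × m ≡ l ^ suc e
  necklace-lyndon-root m m≢[] neck with go m 0 (ℕ-wf (length m)) m≢[] (subst Necklace (sym (++-identityʳ m)) neck)
    where
      go : ∀ z c → Acc _<_ (length z) → z ≢ [] → Necklace (z ^ suc c) →
           ∃ λ l → ∃ λ e → Lyndon k l × z ^ suc c ≡ l ^ suc e
      go z c (acc rec) z≢[] neck with lyndon? k z
      ... | yes L = z , c , L , refl
      ... | no ¬L with non-lyndon-shorter-root z c z≢[] ¬L neck
      ...   | y , e , y≢[] , |y|<|z| , E with go y e (rec |y|<|z|) y≢[] (subst Necklace E neck)
      ...     | l , f , L , E' = l , f , L , trans E E'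
  ... | l , e , L , E = l , e , L , trans (sym (++-identityʳ m)) E

  power-≼-blocks : ∀ a α z → length z ≡ α * length a →
    (∀ s → s < α → a ≼ take (length a) (drop (s * length a) z)) → a ^ α ≼ z
  power-≼-blocks a zero [] _ _ = base _
  power-≼-blocks a (suc α) z |z| blocks with ≼⇒≺⊎≡ (blocks 0 (s≤s z≤n))
  ... | inj₁ a≺ =
    subst (a ^ suc α ≼_) (take++drop≡id (length a) z)
      (≺⇒≼ (≺-extend (a ^ α) (drop (length a) z) a≺ (sym |take|)))
    where
      |take| : length (take (length a) z) ≡ length a
      |take| = length-take-≤ (length a) z (subst (length a ≤_) (sym |z|) (ℕₚ.m≤m+n _ _))
  ... | inj₂ a≡ =
    subst (a ^ suc α ≼_) (trans (cong (_++ drop (length a) z) a≡) (take++drop≡id (length a) z))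
      (≼-prepend a (power-≼-blocks a α (drop (length a) z) |drop| later-blocks))
    where
      |drop| : length (drop (length a) z) ≡ α * length a
      |drop| = trans (length-drop (length a) z) (trans (cong (_∸ length a) |z|) (ℕₚ.m+n∸m≡n (length a) _))
      later-blocks : ∀ s → s < α → a ≼ take (length a) (drop (s * length a) (drop (length a) z))
      later-blocks s s<α = subst (λ t → a ≼ take (length a) t) (sym (drop-drop (length a) (s * length a) z))
                                 (blocks (suc s) (s≤s s<α))

  necklace-factor-≽-prefix : ∀ {m} a r q → m ≡ a ++ r → Necklace m → length a + q ≤ length m →
    a ≼ take (length a) (drop q m)
  necklace-factor-≽-prefix {m} a r q refl neck bound =
    ≼-prefix a (take p D) (subst (a ++ r ≼_) rotation≡ (neck _ (conj-rotate q m))) (sym |take|)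
    where
      p : ℕ
      p = length a
      D : W
      D = drop q m
      rotation≡ : rotate q m ≡ take p D ++ drop p D ++ take q m
      rotation≡ = trans (cong (_++ take q m) (sym (take++drop≡id p D))) (++-assoc (take p D) (drop p D) (take q m))
      |take| : length (take p D) ≡ p
      |take| = length-take-≤ p D (subst (p ≤_) (sym (length-drop q m)) (ℕₚ.m+n≤o⇒m≤o∸n p bound))

  -- Sorting commutes with filtering: both sides are sorted permutations of each other.
  sort-filter : ∀ {Q : W → Set} (Q? : Decidable Q) xs → sort k (filter Q? xs) ≡ filter Q? (sort k xs)
  sort-filter Q? xs =
    Pointwise.Pointwise-≡⇒≡ (Pointwise.map Pointwise.Pointwise-≡⇒≡
      (Sorted.↗↭↗⇒≋ lexTotalOrder (sort-↗ _) (Sorted.filter⁺ lexTotalOrder Q? (sort-↗ xs))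
        (PermHomo.map (TotalOrder.Eq.reflexive lexTotalOrder) (Perm.↭⇒↭ₛ permutation))))
    where
      permutation : sort k (filter Q? xs) Perm.↭ filter Q? (sort k xs)
      permutation = Perm.↭-trans (sort-↭ _) (filter-↭ Q? (Perm.↭-sym (sort-↭ xs)))

  allWords-complete : ∀ x → x ∈ allWords k (length x)
  allWords-complete [] = here refl
  allWords-complete (a ∷ x) =
    ∈-concatMap⁺ (λ b → map (b ∷_) (allWords k (length x)))
                 (lose (∈-allFin a) (∈-map⁺ (a ∷_) (allWords-complete x)))

  allWords-length : ∀ m {x} → x ∈ allWords k m → length x ≡ m
  allWords-length zero (here refl) = refl
  allWords-length (suc m) x∈ with find (∈-concatMap⁻ (λ b → map (b ∷_) (allWords k m)) {allFin k} x∈)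
  ... | b , _ , x∈b with ∈-map⁻ (b ∷_) x∈b
  ... | y , y∈ , refl = cong suc (allWords-length m y∈)

  allWords-unique : ∀ m → Unique (allWords k m)
  allWords-unique zero = [] ∷ []
  allWords-unique (suc m) =
    concatMap-unique _ (allFin k) (Unique.allFin⁺ k) (λ _ → Unique.map⁺ ∷-injectiveʳ (allWords-unique m))
                     different-heads
    where
      different-heads : ∀ {i j : Fin k} {z} → i ∈ allFin k → j ∈ allFin k → i ≢ j →
                        z ∈ map (i ∷_) (allWords k m) → z ∈ map (j ∷_) (allWords k m) → ⊥
      different-heads _ _ i≢j z∈i z∈j with ∈-map⁻ _ z∈i | ∈-map⁻ _ z∈j
      ... | _ , _ , refl | _ , _ , e = i≢j (∷-injectiveˡ e)

  module Rank (n' : ℕ) where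

    n : ℕ
    n = suc n'

    𝓛 : List W
    𝓛 = LyndonDiv k n

    ∈𝓛⁻ : ∀ {l} → l ∈ 𝓛 → Lyndon k l × length l ∣ n
    ∈𝓛⁻ l∈ with ∈-filter⁻ (lyndon? k)
                  {xs = filter (λ x → length x ∣? n) (concatMap (allWords k) (upTo (suc n)))} l∈
    ... | l∈' , L = L , proj₂ (∈-filter⁻ (λ x → length x ∣? n) {xs = concatMap (allWords k) (upTo (suc n))} l∈')

    ∈𝓛⁺ : ∀ {l} → Lyndon k l → length l ∣ n → l ∈ 𝓛
    ∈𝓛⁺ {l} L |l|∣n =
      ∈-filter⁺ (lyndon? k)
        (∈-filter⁺ (λ x → length x ∣? n)
          (∈-concatMap⁺ (allWords k) (lose (∈-upTo⁺ (s≤s (∣⇒≤ |l|∣n))) (allWords-complete l))) |l|∣n) L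

    𝓛-unique : Unique 𝓛
    𝓛-unique =
      Unique.filter⁺ (lyndon? k) (Unique.filter⁺ (λ x → length x ∣? n)
        (concatMap-unique (allWords k) (upTo (suc n)) (Unique.upTo⁺ (suc n)) (λ {m} _ → allWords-unique m)
          (λ _ _ m≢m' z∈ z∈' → m≢m' (trans (sym (allWords-length _ z∈)) (allWords-length _ z∈')))))

    exponent : W → ℕ
    exponent l = _div_ k n (length l)

    exponent-of : ∀ l a → a * length l ≡ n → length l ≢ 0 → exponent l ≡ a
    exponent-of l a a|l|≡n |l|≢0 =
      trans (cong (λ m → _div_ k m (length l)) (sym a|l|≡n)) (exact a (length l) |l|≢0)
      where
        exact : ∀ a d → d ≢ 0 → _div_ k (a * d) d ≡ a
        exact a zero d≢0 = ⊥-elim (d≢0 refl)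
        exact a (suc d) _ = m*n/n≡m a (suc d)

    exponent-positive : ∀ {l} → l ∈ 𝓛 → ∃ λ a → exponent l ≡ suc a × suc a * length l ≡ n
    exponent-positive {l} l∈ with ∈𝓛⁻ l∈
    ... | L , divides (suc a) n≡ = a , exponent-of l (suc a) (sym n≡) (proj₁ L) , sym n≡

    -- The conjugacy class of l ^ exponent l, listed as its first |l| rotations.
    class : W → List W
    class l = applyUpTo (λ i → rotate i (l ^ exponent l)) (length l)

    -- Each member of the class of l ∈ 𝓛 is a rotation of the necklace
    -- l ^ exponent l, hence has it as minimal rotation, and has length n.
    class-⟨⟩ : ∀ {l z} → l ∈ 𝓛 → z ∈ class l → ⟨ z ⟩ ≡ l ^ exponent l
    class-⟨⟩ {l} l∈ z∈ with ∈-applyUpTo⁻ _ z∈ | exponent-positive l∈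
    ... | i , _ , refl | a , e , _ rewrite e =
      ⟨⟩-of-necklace (lyndon-power-necklace l a (proj₁ (∈𝓛⁻ l∈))) (conj-rotate i _)

    class-length : ∀ {l z} → l ∈ 𝓛 → z ∈ class l → length z ≡ n
    class-length {l} l∈ z∈ with ∈-applyUpTo⁻ _ z∈ | exponent-positive l∈
    ... | i , _ , refl | a , e , a|l|≡n rewrite e =
      trans (conj-length (conj-rotate i (l ^ suc a))) (trans (length-^ l (suc a)) a|l|≡n)

    class-unique : ∀ {l} → l ∈ 𝓛 → Unique (class l)
    class-unique {l} l∈ with exponent-positive l∈
    ... | a , e , _ rewrite e =
      Unique.applyUpTo⁺₁ _ (length l) (lyndon-power-rotations-distinct a _ _ (proj₁ (∈𝓛⁻ l∈)))

    -- Classes of distinct Lyndon words are disjoint: the minimal rotation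
    -- l ^ exponent l of any member determines l.
    classes-disjoint : ∀ {l m z} → l ∈ 𝓛 → m ∈ 𝓛 → l ≢ m → z ∈ class l → z ∈ class m → ⊥
    classes-disjoint {l} {m} l∈ m∈ l≢m z∈l z∈m with exponent-positive l∈ | exponent-positive m∈
    ... | a , eₗ , _ | b , eₘ , _ =
      l≢m (lyndon-root-unique a b (proj₁ (∈𝓛⁻ l∈)) (proj₁ (∈𝓛⁻ m∈))
            (subst₂ (λ s t → l ^ s ≡ m ^ t) eₗ eₘ (trans (sym (class-⟨⟩ l∈ z∈l)) (class-⟨⟩ m∈ z∈m))))

    -- Every word of length n lies in the class of the Lyndon root of its minimal rotation.
    classes-cover : ∀ {z} → z ∈ allWords k n → z ∈ concatMap class 𝓛
    classes-cover {z} z∈ with necklace-lyndon-root ⟨ z ⟩ ⟨z⟩≢[] (⟨⟩-necklace z)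
      where
        |⟨z⟩| : length ⟨ z ⟩ ≡ n
        |⟨z⟩| = trans (conj-length (conj-⟨⟩ z)) (allWords-length n z∈)
        ⟨z⟩≢[] : ⟨ z ⟩ ≢ []
        ⟨z⟩≢[] e = ℕₚ.0≢1+n (trans (sym (cong length e)) |⟨z⟩|)
    ... | l , e , L , ⟨z⟩≡
      with conjugate-of-power-is-rotation e (lyndon-nonempty L) (subst (λ t → Conj t z) ⟨z⟩≡ (conj-sym (conj-⟨⟩ z)))
    ... | i , i<|l| , z≡ = ∈-concatMap⁺ class (lose l∈ (subst (_∈ class l) (sym z≡') (∈-applyUpTo⁺ _ i<|l|)))
      where
        n≡ : suc e * length l ≡ n
        n≡ = begin
          suc e * length l        ≡⟨ length-^ l (suc e) ⟨
          length (l ^ suc e)      ≡⟨ cong length ⟨z⟩≡ ⟨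
          length ⟨ z ⟩            ≡⟨ conj-length (conj-⟨⟩ z) ⟩
          length z                ≡⟨ allWords-length n z∈ ⟩
          n                       ∎
          where open ≡-Reasoning
        l∈ : l ∈ 𝓛
        l∈ = ∈𝓛⁺ L (divides (suc e) (sym n≡))
        z≡' : z ≡ rotate i (l ^ exponent l)
        z≡' = trans z≡ (cong (λ a → rotate i (l ^ a)) (sym (exponent-of l (suc e) n≡ (proj₁ L))))

    classes-unique : Unique (concatMap class 𝓛)
    classes-unique = concatMap-unique class 𝓛 𝓛-unique class-unique classes-disjoint

    classes-sound : ∀ {z} → z ∈ concatMap class 𝓛 → z ∈ allWords k n
    classes-sound {z} z∈ with find (∈-concatMap⁻ class {𝓛} z∈)
    ... | l , l∈ , z∈l = subst (λ m → z ∈ allWords k m) (class-length l∈ z∈l) (allWords-complete z)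

    -- Raising the words of 𝓛 to their exponents preserves ≼: if a is not a
    -- prefix of b the first mismatch decides; if b = a v, every block of
    -- length |a| of the necklace b ^ exponent b is ≽ a.
    exponent-monotone : ∀ {a b} → a ∈ 𝓛 → b ∈ 𝓛 → a ≼ b → a ^ exponent a ≼ b ^ exponent b
    exponent-monotone {a} {b} a∈ b∈ a≼b with ≼⇒≺⊎≡ a≼b
    ... | inj₂ refl = ≼-refl
    ... | inj₁ a≺b with exponent-positive a∈ | exponent-positive b∈ | ≺-cases a≺b
    ...   | α , ea , _ | β , eb , _ | inj₂ mismatch rewrite ea | eb = ≺⇒≼ (mismatch _ _)
    ...   | α , ea , α|a|≡n | β , eb , β|b|≡n | inj₁ (v , refl , _) rewrite ea | eb =
      power-≼-blocks a (suc α) ((a ++ v) ^ suc β) |b^β|≡ block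
      where
        |b^β|≡ : length ((a ++ v) ^ suc β) ≡ suc α * length a
        |b^β|≡ = trans (length-^ (a ++ v) (suc β)) (trans β|b|≡n (sym α|a|≡n))
        block : ∀ s → s < suc α → a ≼ take (length a) (drop (s * length a) ((a ++ v) ^ suc β))
        block s s<α =
          necklace-factor-≽-prefix a (v ++ (a ++ v) ^ β) (s * length a) (++-assoc a v _)
            (lyndon-power-necklace (a ++ v) β (proj₁ (∈𝓛⁻ b∈)))
            (ℕₚ.≤-trans (ℕₚ.*-monoˡ-≤ (length a) s<α) (ℕₚ.≤-reflexive (sym |b^β|≡)))

    module Bounded (w : W) where

      P? : (x : W) → Dec (⟨ x ⟩ ≼ w)
      P? x = _≤ₗ?_ k (minRot k x) w

      Q? : (l : W) → Dec (l ^ exponent l ≼ w)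
      Q? l = _≤ₗ?_ k (_^ʷ_ k l (_div_ k n (length l))) w

      -- All members of a class have the same minimal rotation, so P? keeps
      -- the class of l entirely when Q l holds and drops it otherwise.
      class-kept : ∀ {l} → l ∈ 𝓛 → l ^ exponent l ≼ w → filter P? (class l) ≡ class l
      class-kept l∈ q = filter-all P? (All.tabulate (λ z∈ → subst (_≼ w) (sym (class-⟨⟩ l∈ z∈)) q))

      class-dropped : ∀ {l} → l ∈ 𝓛 → ¬ (l ^ exponent l ≼ w) → filter P? (class l) ≡ []
      class-dropped l∈ ¬q = filter-none P? (All.tabulate (λ z∈ p → ¬q (subst (_≼ w) (class-⟨⟩ l∈ z∈) p)))

      count-classes : ∀ xs → (∀ {l} → l ∈ xs → l ∈ 𝓛) →
        length (filter P? (concatMap class xs)) ≡ sum (map length (filter Q? xs))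
      count-classes [] _ = refl
      count-classes (l ∷ xs) xs⊆𝓛 with Q? l
      ... | yes q = begin
        length (filter P? (class l ++ concatMap class xs))               ≡⟨ cong length (filter-++ P? (class l) _) ⟩
        length (filter P? (class l) ++ filter P? (concatMap class xs))  ≡⟨ length-++ (filter P? (class l)) ⟩
        length (filter P? (class l)) + length (filter P? (concatMap class xs))
          ≡⟨ cong₂ _+_ (trans (cong length (class-kept l∈ q)) (length-applyUpTo _ (length l)))
                       (count-classes xs (xs⊆𝓛 ∘ there)) ⟩
        length l + sum (map length (filter Q? xs))                      ∎
        where
          open ≡-Reasoning
          l∈ : l ∈ 𝓛
          l∈ = xs⊆𝓛 (here refl)
      ... | no ¬q = begin
        length (filter P? (class l ++ concatMap class xs))               ≡⟨ cong length (filter-++ P? (class l) _) ⟩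
        length (filter P? (class l) ++ filter P? (concatMap class xs))
          ≡⟨ cong (λ c → length (c ++ _)) (class-dropped (xs⊆𝓛 (here refl)) ¬q) ⟩
        length (filter P? (concatMap class xs))                         ≡⟨ count-classes xs (xs⊆𝓛 ∘ there) ⟩
        sum (map length (filter Q? xs))                                 ∎
        where open ≡-Reasoning

      -- The length statement: C(w) is the part of the partition of Σ^n
      -- formed by the classes of the words in L(w).
      Lw-length : sum (map length (Lw k n w)) ≡ length (C k n w)
      Lw-length = sym (trans (unique-same-members-length (Unique.filter⁺ P? (allWords-unique n))
                                                         (Unique.filter⁺ P? classes-unique) cover sound)
                             (count-classes 𝓛 (λ l∈ → l∈)))
        where
          cover : ∀ {z} → z ∈ C k n w → z ∈ filter P? (concatMap class 𝓛)
          cover z∈ = let z∈Σⁿ , p = ∈-filter⁻ P? {xs = allWords k n} z∈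
                     in ∈-filter⁺ P? (classes-cover z∈Σⁿ) p
          sound : ∀ {z} → z ∈ filter P? (concatMap class 𝓛) → z ∈ C k n w
          sound z∈ = let z∈cl , p = ∈-filter⁻ P? {xs = concatMap class 𝓛} z∈
                     in ∈-filter⁺ P? (classes-sound z∈cl) p

      -- The prefix statement: L(w) is a down-closed part of the sorted list
      -- L^(n), so its sorted concatenation starts dB_n.
      Lw-prefix : Prefix _≡_ (concat (sort k (Lw k n w))) (dB k n)
      Lw-prefix
        with filter-down-closed-prefix Q? (sort k 𝓛) (Sorted.Sorted⇒AllPairs lexTotalOrder (sort-↗ 𝓛)) down-closed
        where
          down-closed : ∀ {a b} → a ∈ sort k 𝓛 → b ∈ sort k 𝓛 → a ≼ b →
                        b ^ exponent b ≼ w → a ^ exponent a ≼ w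
          down-closed a∈ b∈ a≼b =
            ≼-trans (exponent-monotone (∈-resp-↭ (sort-↭ 𝓛) a∈) (∈-resp-↭ (sort-↭ 𝓛) b∈) a≼b)
      ... | zs , sorted≡ =
        subst₂ (Prefix _≡_) (cong concat (sym (sort-filter Q? 𝓛)))
               (trans (concat-++ (filter Q? (sort k 𝓛)) zs) (cong concat (sym sorted≡)))
               (fromView (Pointwise.≡⇒Pointwise-≡ refl ++ᵛ concat zs))

lemma12 : (k n : ℕ) → n ≥ 1 → (w : Word k) → length w ≡ n →
    Prefix _≡_ (concat (sort k (Lw k n w))) (dB k n)
      × (sum (map length (Lw k n w)) ≡ length (C k n w))
lemma12 k (suc n') _ w _ = Lw-prefix , Lw-length
  where open Combinatorics.Rank.Bounded k n' w
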